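{- Let $\hat{\mathcal R}$ and $\hat{\mathcal Q}$ be two sets of node-disjoint paths in a graph $\hat G$, and let $\hat w,\hat D>0$ be integers. Assume that each path $Q\in\hat{\mathcal Q}$ intersects at least $2\hat D$ distinct paths of $\hat{\mathcal R}$, and that $|\hat{\mathcal Q}|\geq 2|\hat{\mathcal R}|\hat w/\hat D$. Then there is a partition $(\hat{\mathcal R}',\hat{\mathcal R}'')$ of $\hat{\mathcal R}$ and a subset $\hat{\mathcal Q}'\subseteq\hat{\mathcal Q}$ such that $(\hat{\mathcal R}',\hat{\mathcal Q}')$ is a $(\hat w,\hat D)$-intersecting pair of path sets, $|\hat{\mathcal Q}'|\geq|\hat{\mathcal Q}|/2$, and every path of $\hat{\mathcal R}''$ intersects at most $\hat w$ paths of $\hat{\mathcal Q}'$.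
   Context: Two paths intersect if they share a vertex. Within each of $\hat{\mathcal R}$ and $\hat{\mathcal Q}$ the paths are pairwise vertex-disjoint, but a path of $\hat{\mathcal R}$ may intersect a path of $\hat{\mathcal Q}$. A pair $(\mathcal R,\mathcal Q)$ of sets of node-disjoint paths is $(w,D)$-intersecting if each path of $\mathcal R$ intersects at least $w$ distinct paths of $\mathcal Q$ and each path of $\mathcal Q$ intersects at least $D$ distinct paths of $\mathcal R$. -}

module Defs where

open import Data.Nat using (ℕ; _≤_)
open import Data.Fin using (Fin)
open import Data.Fin.Subset using (Subset; _∈_; _⊆_; ∣_∣)
open import Data.List using (List; [])
open import Data.List.Relation.Unary.Linked using (Linked)
open import Data.List.Relation.Unary.Unique.Propositional using (Unique)
import Data.List.Membership.Propositional as LM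
open import Data.Product using (Σ; ∃; _×_; proj₁)
open import Relation.Binary.PropositionalEquality using (_≢_)
open import Relation.Nullary using (¬_)

record Graph : Set₁ where
  field
    n   : ℕ
    Adj : Fin n → Fin n → Set

open Graph public

record IsPath (G : Graph) (p : List (Fin (n G))) : Set where
  field
    nonempty : p ≢ []
    linked   : Linked (Adj G) p
    distinct : Unique p

Path : Graph → Set
Path G = Σ (List (Fin (n G))) (IsPath G)

Intersect : {G : Graph} → Path G → Path G → Set
Intersect P Q = ∃ λ v → (v LM.∈ proj₁ P) × (v LM.∈ proj₁ Q)

NodeDisjoint : {G : Graph} {k : ℕ} → (Fin k → Path G) → Set
NodeDisjoint {k = k} F = (i j : Fin k) → i ≢ j → ¬ Intersect (F i) (F j)

IntersectsAtLeast : {G : Graph} {m : ℕ} → ℕ → Path G → (Fin m → Path G) → Subset m → Set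
IntersectsAtLeast {m = m} t P F S =
  ∃ λ (T : Subset m) → (T ⊆ S) × (t ≤ ∣ T ∣) × ((j : Fin m) → j ∈ T → Intersect P (F j))

IntersectsAtMost : {G : Graph} {m : ℕ} → ℕ → Path G → (Fin m → Path G) → Subset m → Set
IntersectsAtMost {m = m} t P F S =
  (T : Subset m) → T ⊆ S → ((j : Fin m) → j ∈ T → Intersect P (F j)) → ∣ T ∣ ≤ t

IsIntersectingPair : {G : Graph} {r q : ℕ} → ℕ → ℕ →
  (Fin r → Path G) → Subset r → (Fin q → Path G) → Subset q → Set
IsIntersectingPair {r = r} {q} w D R SR Q SQ =
  ((i : Fin r) → i ∈ SR → IntersectsAtLeast w (R i) Q SQ) ×
  ((j : Fin q) → j ∈ SQ → IntersectsAtLeast D (Q j) R SR)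

-- Repeatedly discard a path of R that meets fewer than w kept paths of Q, or a
-- path of Q that meets fewer than D kept paths of R; what survives is
-- (w, D)-intersecting. The potential D·|Q discarded| + (incidences between
-- discarded R-paths and kept Q-paths) never exceeds w·|R discarded|: dropping an
-- R-path adds less than w on the left and exactly w on the right, and dropping a
-- Q-path costs D but, since it meets at least 2D paths of R and fewer than D of
-- the kept ones, also removes at least D incidences. Hence at most rw/D ≤ q/2
-- paths of Q are discarded.
module Submission where

open import Defs
open import Data.Nat using (ℕ; _≤_; _*_; _<_)
open import Data.Fin using (Fin)
open import Data.Fin.Subset using (Subset; ⊤; ∁; _∈_; ∣_∣)
open import Data.Product using (∃; _×_)

open import Data.Bool using (Bool; true; false)
open import Data.Bool.Properties using (T-≡)
open import Data.Empty using (⊥-elim)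
open import Data.Fin using (zero; suc)
open import Data.Fin.Properties using (any?) renaming (_≟_ to _≟ᶠ_)
open import Data.Fin.Subset using (⊥; _∉_; _∩_; _⊆_; inside; outside)
open import Data.Fin.Subset.Properties
  using ( _∈?_; ∈⊤; x∈p⇒x∉∁p; x∈∁p⇒x∉p; p∩q⊆p; x∈p∩q⁺; x∈p∩q⁻
        ; p⊆q⇒∣p∣≤∣q∣; ∣p∣≤n; ∣⊥∣≡0; ∣∁p∣≡n∸∣p∣)
open import Data.List.Membership.Propositional using (find; lose)
import Data.List.Membership.DecPropositional as DecMembership
import Data.List.Relation.Unary.Any as Any
open import Data.Nat using (zero; suc; _+_; _<?_; z≤n; s≤s; NonZero; >-nonZero)
open import Data.Nat.Induction using (<-wellFounded)
open import Data.Nat.Properties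
import Algebra.Properties.CommutativeSemigroup as CommutativeSemigroupProperties
open CommutativeSemigroupProperties +-commutativeSemigroup using (interchange; x∙yz≈y∙xz)
open import Data.Product using (∃₂; _,_; proj₂)
open import Data.Sum using (_⊎_; inj₁; inj₂)
open import Data.Vec using (_∷_; []; here; there; tabulate; _[_]≔_)
open import Data.Vec.Properties using (lookup∘tabulate; []=⇒lookup; lookup⇒[]=; map-[]≔)
open import Function using (_∘_; Equivalence; mk⇔)
open import Induction.WellFounded using (Acc; acc)
open import Relation.Nullary using (Dec; yes; no; does)
open import Relation.Nullary.Decidable using (_×-dec_; map′; toWitness; isYes≗does; dec-true; does-⇔)
open import Relation.Binary.PropositionalEquality

sumOver : ∀ {n} → Subset n → (Fin n → ℕ) → ℕ
sumOver []            f = 0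
sumOver (inside  ∷ p) f = f zero + sumOver p (f ∘ suc)
sumOver (outside ∷ p) f = sumOver p (f ∘ suc)

sumOver-cong : ∀ {n} (p : Subset n) {f g : Fin n → ℕ} →
               (∀ k → f k ≡ g k) → sumOver p f ≡ sumOver p g
sumOver-cong []            f≗g = refl
sumOver-cong (inside  ∷ p) f≗g = cong₂ _+_ (f≗g zero) (sumOver-cong p (f≗g ∘ suc))
sumOver-cong (outside ∷ p) f≗g = sumOver-cong p (f≗g ∘ suc)

sumOver-+ : ∀ {n} (p : Subset n) (f g : Fin n → ℕ) →
            sumOver p f + sumOver p g ≡ sumOver p (λ k → f k + g k)
sumOver-+ []            f g = refl
sumOver-+ (inside  ∷ p) f g =
  trans (interchange (f zero) _ (g zero) _) (cong ((f zero + g zero) +_) (sumOver-+ p _ _))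
sumOver-+ (outside ∷ p) f g = sumOver-+ p _ _

sumOver-remove : ∀ {n} (p : Subset n) {i} (f : Fin n → ℕ) → i ∈ p →
                 sumOver (p [ i ]≔ outside) f + f i ≡ sumOver p f
sumOver-remove (inside  ∷ p) f here        = +-comm (sumOver p (f ∘ suc)) (f zero)
sumOver-remove (inside  ∷ p) f (there i∈p) =
  trans (+-assoc (f zero) _ _) (cong (f zero +_) (sumOver-remove p (f ∘ suc) i∈p))
sumOver-remove (outside ∷ p) f (there i∈p) = sumOver-remove p (f ∘ suc) i∈p

sumOver-insert : ∀ {n} (p : Subset n) {i} (f : Fin n → ℕ) → i ∉ p →
                 sumOver (p [ i ]≔ inside) f ≡ f i + sumOver p f
sumOver-insert (inside  ∷ p) {zero}  f i∉p = ⊥-elim (i∉p here)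
sumOver-insert (outside ∷ p) {zero}  f i∉p = refl
sumOver-insert (inside  ∷ p) {suc i} f i∉p =
  trans (cong (f zero +_) (sumOver-insert p (f ∘ suc) (i∉p ∘ there)))
        (x∙yz≈y∙xz (f zero) (f (suc i)) (sumOver p (f ∘ suc)))
sumOver-insert (outside ∷ p) {suc i} f i∉p = sumOver-insert p (f ∘ suc) (i∉p ∘ there)

sumOver-∁ : ∀ {n} (p : Subset n) (f : Fin n → ℕ) → sumOver p f + sumOver (∁ p) f ≡ sumOver ⊤ f
sumOver-∁ []            f = refl
sumOver-∁ (inside  ∷ p) f = trans (+-assoc (f zero) _ _) (cong (f zero +_) (sumOver-∁ p (f ∘ suc)))
sumOver-∁ (outside ∷ p) f =
  trans (x∙yz≈y∙xz (sumOver p (f ∘ suc)) (f zero) (sumOver (∁ p) (f ∘ suc)))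
        (cong (f zero +_) (sumOver-∁ p (f ∘ suc)))

sumOver-⊥ : ∀ {n} (f : Fin n → ℕ) → sumOver ⊥ f ≡ 0
sumOver-⊥ {zero}  f = refl
sumOver-⊥ {suc n} f = sumOver-⊥ (f ∘ suc)

∁⊤≡⊥ : ∀ {n} → ∁ (⊤ {n}) ≡ ⊥
∁⊤≡⊥ {zero}  = refl
∁⊤≡⊥ {suc n} = cong (outside ∷_) ∁⊤≡⊥

∁-remove : ∀ {n} (p : Subset n) (i : Fin n) → ∁ (p [ i ]≔ outside) ≡ ∁ p [ i ]≔ inside
∁-remove p i = map-[]≔ _ p i

∈-insert⁻ : ∀ {n} (p : Subset n) {i x} → x ∈ p [ i ]≔ inside → x ≡ i ⊎ x ∈ p
∈-insert⁻ (_ ∷ p) {zero}  here        = inj₁ refl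
∈-insert⁻ (_ ∷ p) {zero}  (there x∈p) = inj₂ (there x∈p)
∈-insert⁻ (_ ∷ p) {suc i} here        = inj₂ here
∈-insert⁻ (_ ∷ p) {suc i} (there x∈)  with ∈-insert⁻ p x∈
... | inj₁ x≡i = inj₁ (cong suc x≡i)
... | inj₂ x∈p = inj₂ (there x∈p)

∣p[i]≔outside∣<∣p∣ : ∀ {n} (p : Subset n) {i} → i ∈ p → ∣ p [ i ]≔ outside ∣ < ∣ p ∣
∣p[i]≔outside∣<∣p∣ (inside  ∷ p) here        = n<1+n ∣ p ∣
∣p[i]≔outside∣<∣p∣ (inside  ∷ p) (there i∈p) = s≤s (∣p[i]≔outside∣<∣p∣ p i∈p)
∣p[i]≔outside∣<∣p∣ (outside ∷ p) (there i∈p) = ∣p[i]≔outside∣<∣p∣ p i∈p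

∣p[i]≔inside∣≡1+∣p∣ : ∀ {n} (p : Subset n) {i} → i ∉ p → ∣ p [ i ]≔ inside ∣ ≡ suc ∣ p ∣
∣p[i]≔inside∣≡1+∣p∣ (inside  ∷ p) {zero}  i∉p = ⊥-elim (i∉p here)
∣p[i]≔inside∣≡1+∣p∣ (outside ∷ p) {zero}  i∉p = refl
∣p[i]≔inside∣≡1+∣p∣ (inside  ∷ p) {suc i} i∉p = cong suc (∣p[i]≔inside∣≡1+∣p∣ p (i∉p ∘ there))
∣p[i]≔inside∣≡1+∣p∣ (outside ∷ p) {suc i} i∉p = ∣p[i]≔inside∣≡1+∣p∣ p (i∉p ∘ there)

∣p∣+∣∁p∣≡n : ∀ {n} (p : Subset n) → ∣ p ∣ + ∣ ∁ p ∣ ≡ n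
∣p∣+∣∁p∣≡n p = trans (cong (∣ p ∣ +_) (∣∁p∣≡n∸∣p∣ p)) (m+[n∸m]≡n (∣p∣≤n p))

∈-tabulate⁻ : ∀ {n} (g : Fin n → Bool) {x} → x ∈ tabulate g → g x ≡ true
∈-tabulate⁻ g {x} x∈ = trans (sym (lookup∘tabulate g x)) ([]=⇒lookup x∈)

∈-tabulate⁺ : ∀ {n} (g : Fin n → Bool) {x} → g x ≡ true → x ∈ tabulate g
∈-tabulate⁺ g {x} gx = lookup⇒[]= x (tabulate g) (trans (lookup∘tabulate g x) gx)

indicator : Bool → ℕ
indicator true  = 1
indicator false = 0

∣p∩tabulate∣≡sumOver : ∀ {n} (p : Subset n) (g : Fin n → Bool) →
                       ∣ p ∩ tabulate g ∣ ≡ sumOver p (indicator ∘ g)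
∣p∩tabulate∣≡sumOver []            g = refl
∣p∩tabulate∣≡sumOver (outside ∷ p) g = ∣p∩tabulate∣≡sumOver p (g ∘ suc)
∣p∩tabulate∣≡sumOver (inside  ∷ p) g with g zero
... | true  = cong suc (∣p∩tabulate∣≡sumOver p (g ∘ suc))
... | false = ∣p∩tabulate∣≡sumOver p (g ∘ suc)

module Pruning {r q : ℕ} (a : Fin r → Fin q → ℕ) (w D : ℕ)
               (column-heavy : ∀ j → 2 * D ≤ sumOver ⊤ (λ i → a i j)) where

  rowDeg : Subset q → Fin r → ℕ
  rowDeg Q′ i = sumOver Q′ (a i)

  colDeg : Subset r → Fin q → ℕ
  colDeg R′ j = sumOver R′ (λ i → a i j)

  record Invariant (R′ : Subset r) (Q′ : Subset q) : Set where
    field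
      discarded-light : ∀ i → i ∈ ∁ R′ → rowDeg Q′ i ≤ w
      potential       : D * ∣ ∁ Q′ ∣ + sumOver (∁ R′) (rowDeg Q′) ≤ w * ∣ ∁ R′ ∣

  open Invariant public

  Stable : Subset r → Subset q → Set
  Stable R′ Q′ = (∀ i → i ∈ R′ → w ≤ rowDeg Q′ i) × (∀ j → j ∈ Q′ → D ≤ colDeg R′ j)

  invariant-⊤ : Invariant ⊤ ⊤
  invariant-⊤ .discarded-light i i∈∁⊤ = ⊥-elim (x∈∁p⇒x∉p i∈∁⊤ ∈⊤)
  invariant-⊤ .potential
    rewrite ∁⊤≡⊥ {q} | ∁⊤≡⊥ {r} | ∣⊥∣≡0 q | sumOver-⊥ (rowDeg ⊤) | *-zeroʳ D = z≤n

  discard-row : ∀ {R′ Q′ i} → i ∈ R′ → rowDeg Q′ i < w →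
                Invariant R′ Q′ → Invariant (R′ [ i ]≔ outside) Q′
  discard-row {R′} {Q′} {i} i∈R′ light inv = record
    { discarded-light = still-light
    ; potential       = subst (λ X → D * ∣ ∁ Q′ ∣ + sumOver X (rowDeg Q′) ≤ w * ∣ X ∣)
                              (sym (∁-remove R′ i)) grown
    }
    where
      i∉∁R′ : i ∉ ∁ R′
      i∉∁R′ = x∈p⇒x∉∁p i∈R′

      still-light : ∀ x → x ∈ ∁ (R′ [ i ]≔ outside) → rowDeg Q′ x ≤ w
      still-light x x∈ with ∈-insert⁻ (∁ R′) (subst (x ∈_) (∁-remove R′ i) x∈)
      ... | inj₁ refl = <⇒≤ light
      ... | inj₂ x∈∁R′ = discarded-light inv x x∈∁R′

      grown : D * ∣ ∁ Q′ ∣ + sumOver (∁ R′ [ i ]≔ inside) (rowDeg Q′) ≤ w * ∣ ∁ R′ [ i ]≔ inside ∣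
      grown = begin
        D * ∣ ∁ Q′ ∣ + sumOver (∁ R′ [ i ]≔ inside) (rowDeg Q′)
          ≡⟨ cong (D * ∣ ∁ Q′ ∣ +_) (sumOver-insert (∁ R′) (rowDeg Q′) i∉∁R′) ⟩
        D * ∣ ∁ Q′ ∣ + (rowDeg Q′ i + sumOver (∁ R′) (rowDeg Q′))
          ≡⟨ x∙yz≈y∙xz (D * ∣ ∁ Q′ ∣) (rowDeg Q′ i) (sumOver (∁ R′) (rowDeg Q′)) ⟩
        rowDeg Q′ i + (D * ∣ ∁ Q′ ∣ + sumOver (∁ R′) (rowDeg Q′))
          ≤⟨ +-mono-≤ (<⇒≤ light) (potential inv) ⟩
        w + w * ∣ ∁ R′ ∣
          ≡⟨ *-suc w ∣ ∁ R′ ∣ ⟨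
        w * suc ∣ ∁ R′ ∣
          ≡⟨ cong (w *_) (∣p[i]≔inside∣≡1+∣p∣ (∁ R′) i∉∁R′) ⟨
        w * ∣ ∁ R′ [ i ]≔ inside ∣ ∎
        where open ≤-Reasoning

  light-column-mostly-discarded : ∀ R′ j → colDeg R′ j < D → D ≤ colDeg (∁ R′) j
  light-column-mostly-discarded R′ j light = +-cancelˡ-≤ D D (colDeg (∁ R′) j) (begin
    D + D                          ≡⟨ cong (D +_) (+-identityʳ D) ⟨
    2 * D                          ≤⟨ column-heavy j ⟩
    sumOver ⊤ (λ i → a i j)        ≡⟨ sumOver-∁ R′ (λ i → a i j) ⟨
    colDeg R′ j + colDeg (∁ R′) j  ≤⟨ +-monoˡ-≤ (colDeg (∁ R′) j) (<⇒≤ light) ⟩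
    D + colDeg (∁ R′) j            ∎)
    where open ≤-Reasoning

  discard-column : ∀ {R′ Q′ j} → j ∈ Q′ → colDeg R′ j < D →
                   Invariant R′ Q′ → Invariant R′ (Q′ [ j ]≔ outside)
  discard-column {R′} {Q′} {j} j∈Q′ light inv = record
    { discarded-light = λ x x∈ →
        ≤-trans (subst (rowDeg Q″ x ≤_) (row-split x) (m≤m+n _ _)) (discarded-light inv x x∈)
    ; potential       = subst (λ X → D * ∣ X ∣ + sumOver (∁ R′) (rowDeg Q″) ≤ w * ∣ ∁ R′ ∣)
                              (sym (∁-remove Q′ j)) shrunk
    }
    where
      Q″ : Subset q
      Q″ = Q′ [ j ]≔ outside

      j∉∁Q′ : j ∉ ∁ Q′
      j∉∁Q′ = x∈p⇒x∉∁p j∈Q′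

      row-split : ∀ x → rowDeg Q″ x + a x j ≡ rowDeg Q′ x
      row-split x = sumOver-remove Q′ (a x) j∈Q′

      incidences-split : sumOver (∁ R′) (rowDeg Q″) + colDeg (∁ R′) j ≡ sumOver (∁ R′) (rowDeg Q′)
      incidences-split = trans (sumOver-+ (∁ R′) _ _) (sumOver-cong (∁ R′) row-split)

      shrunk : D * ∣ ∁ Q′ [ j ]≔ inside ∣ + sumOver (∁ R′) (rowDeg Q″) ≤ w * ∣ ∁ R′ ∣
      shrunk = begin
        D * ∣ ∁ Q′ [ j ]≔ inside ∣ + sumOver (∁ R′) (rowDeg Q″)
          ≡⟨ cong (λ c → D * c + sumOver (∁ R′) (rowDeg Q″)) (∣p[i]≔inside∣≡1+∣p∣ (∁ Q′) j∉∁Q′) ⟩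
        D * suc ∣ ∁ Q′ ∣ + sumOver (∁ R′) (rowDeg Q″)
          ≡⟨ cong (_+ sumOver (∁ R′) (rowDeg Q″)) (trans (*-suc D _) (+-comm D _)) ⟩
        (D * ∣ ∁ Q′ ∣ + D) + sumOver (∁ R′) (rowDeg Q″)
          ≡⟨ +-assoc (D * ∣ ∁ Q′ ∣) D _ ⟩
        D * ∣ ∁ Q′ ∣ + (D + sumOver (∁ R′) (rowDeg Q″))
          ≤⟨ +-monoʳ-≤ (D * ∣ ∁ Q′ ∣) (+-monoˡ-≤ _ (light-column-mostly-discarded R′ j light)) ⟩
        D * ∣ ∁ Q′ ∣ + (colDeg (∁ R′) j + sumOver (∁ R′) (rowDeg Q″))
          ≡⟨ cong (D * ∣ ∁ Q′ ∣ +_) (trans (+-comm (colDeg (∁ R′) j) _) incidences-split) ⟩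
        D * ∣ ∁ Q′ ∣ + sumOver (∁ R′) (rowDeg Q′)
          ≤⟨ potential inv ⟩
        w * ∣ ∁ R′ ∣ ∎
        where open ≤-Reasoning

  size : Subset r → Subset q → ℕ
  size R′ Q′ = ∣ R′ ∣ + ∣ Q′ ∣

  Shrinks : Subset r → Subset q → Set
  Shrinks R′ Q′ = ∃₂ λ R″ Q″ → Invariant R″ Q″ × size R″ Q″ < size R′ Q′

  stable-or-shrinks : ∀ R′ Q′ → Invariant R′ Q′ → Stable R′ Q′ ⊎ Shrinks R′ Q′
  stable-or-shrinks R′ Q′ inv
    with any? (λ i → (i ∈? R′) ×-dec (rowDeg Q′ i <? w))
  ... | yes (i , i∈R′ , light) =
    inj₂ (_ , Q′ , discard-row i∈R′ light inv , +-monoˡ-< ∣ Q′ ∣ (∣p[i]≔outside∣<∣p∣ R′ i∈R′))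
  ... | no no-light-row
    with any? (λ j → (j ∈? Q′) ×-dec (colDeg R′ j <? D))
  ...   | yes (j , j∈Q′ , light) =
    inj₂ (R′ , _ , discard-column j∈Q′ light inv , +-monoʳ-< ∣ R′ ∣ (∣p[i]≔outside∣<∣p∣ Q′ j∈Q′))
  ...   | no no-light-column =
    inj₁ ( (λ i i∈R′ → ≮⇒≥ (λ light → no-light-row (i , i∈R′ , light)))
         , (λ j j∈Q′ → ≮⇒≥ (λ light → no-light-column (j , j∈Q′ , light))) )

  prune-from : ∀ R′ Q′ → Acc _<_ (size R′ Q′) → Invariant R′ Q′ →
               ∃₂ λ R″ Q″ → Invariant R″ Q″ × Stable R″ Q″
  prune-from R′ Q′ (acc smaller) inv with stable-or-shrinks R′ Q′ inv
  ... | inj₁ stable                    = R′ , Q′ , inv , stable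
  ... | inj₂ (R″ , Q″ , inv″ , shrunk) = prune-from R″ Q″ (smaller shrunk) inv″

  prune : ∃₂ λ R′ Q′ → Invariant R′ Q′ × Stable R′ Q′
  prune = prune-from ⊤ ⊤ (<-wellFounded _) invariant-⊤

Intersect-sym : {G : Graph} {P Q : Path G} → Intersect P Q → Intersect Q P
Intersect-sym (v , v∈P , v∈Q) = v , v∈Q , v∈P

intersect? : {G : Graph} (P Q : Path G) → Dec (Intersect P Q)
intersect? {G} (p , _) (p′ , _) =
  map′ (λ common → let (v , v∈p , v∈p′) = find common in v , v∈p , v∈p′)
       (λ (v , v∈p , v∈p′) → lose v∈p v∈p′)
       (Any.any? (λ v → DecMembership._∈?_ (_≟ᶠ_ {n G}) v p′) p)

intersect?-comm : {G : Graph} (P Q : Path G) → does (intersect? P Q) ≡ does (intersect? Q P)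
intersect?-comm P Q =
  does-⇔ (mk⇔ (Intersect-sym {P = P} {Q}) (Intersect-sym {P = Q} {P})) (intersect? P Q) (intersect? Q P)

module _ {G : Graph} {m : ℕ} (P : Path G) (F : Fin m → Path G) where

  meets : Fin m → Bool
  meets j = does (intersect? P (F j))

  meetCount : Subset m → ℕ
  meetCount S = sumOver S (indicator ∘ meets)

  meets⁺ : ∀ {j} → Intersect P (F j) → meets j ≡ true
  meets⁺ = dec-true (intersect? P (F _))

  meets⁻ : ∀ {j} → meets j ≡ true → Intersect P (F j)
  meets⁻ {j} meets-j =
    toWitness {a? = intersect? P (F j)} (Equivalence.from T-≡ (trans (isYes≗does _) meets-j))

  atLeast-meetCount : ∀ {t S} → t ≤ meetCount S → IntersectsAtLeast t P F S
  atLeast-meetCount {t} {S} t≤ =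
    S ∩ tabulate meets , p∩q⊆p S _ ,
    subst (t ≤_) (sym (∣p∩tabulate∣≡sumOver S meets)) t≤ ,
    λ j j∈ → meets⁻ (∈-tabulate⁻ meets (proj₂ (x∈p∩q⁻ S _ j∈)))

  meeting-subset-≤-meetCount : ∀ {S T} → T ⊆ S → (∀ j → j ∈ T → Intersect P (F j)) →
                               ∣ T ∣ ≤ meetCount S
  meeting-subset-≤-meetCount {S} T⊆S meet = ≤-trans
    (p⊆q⇒∣p∣≤∣q∣ (λ {j} j∈T → x∈p∩q⁺ (T⊆S j∈T , ∈-tabulate⁺ meets (meets⁺ (meet j j∈T)))))
    (≤-reflexive (∣p∩tabulate∣≡sumOver S meets))

  meetCount-atLeast : ∀ {t S} → IntersectsAtLeast t P F S → t ≤ meetCount S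
  meetCount-atLeast (T , T⊆S , t≤∣T∣ , meet) = ≤-trans t≤∣T∣ (meeting-subset-≤-meetCount T⊆S meet)

  atMost-meetCount : ∀ {t S} → meetCount S ≤ t → IntersectsAtMost t P F S
  atMost-meetCount count≤t T T⊆S meet = ≤-trans (meeting-subset-≤-meetCount T⊆S meet) count≤t

prune-intersecting : {G : Graph} {r q : ℕ} (R : Fin r → Path G) (Q : Fin q → Path G) (w D : ℕ) →
  ((j : Fin q) → IntersectsAtLeast (2 * D) (Q j) R ⊤) →
  ∃₂ λ (R′ : Subset r) (Q′ : Subset q) →
    IsIntersectingPair w D R R′ Q Q′ ×
    D * ∣ ∁ Q′ ∣ ≤ w * ∣ ∁ R′ ∣ ×
    ((i : Fin r) → i ∈ ∁ R′ → IntersectsAtMost w (R i) Q Q′)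
prune-intersecting {r = r} {q} R Q w D heavy =
  let (R′ , Q′ , inv , rows-heavy , columns-heavy) = prune in
  R′ , Q′ ,
  ( (λ i i∈R′ → atLeast-meetCount (R i) Q (rows-heavy i i∈R′))
  , (λ j j∈Q′ → atLeast-meetCount (Q j) R (subst (D ≤_) (column R′ j) (columns-heavy j j∈Q′))) ) ,
  m+n≤o⇒m≤o _ (potential inv) ,
  (λ i i∈∁R′ → atMost-meetCount (R i) Q (discarded-light inv i i∈∁R′))
  where
    a : Fin r → Fin q → ℕ
    a i j = indicator (meets (R i) Q j)

    column : ∀ X j → sumOver X (λ i → a i j) ≡ meetCount (Q j) R X
    column X j = sumOver-cong X (λ i → cong indicator (intersect?-comm (R i) (Q j)))

    open Pruning a w D (λ j → subst (2 * D ≤_) (sym (column ⊤ j)) (meetCount-atLeast (Q j) R (heavy j)))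

at-least-half-kept : ∀ {q kept dropped r w D} .{{_ : NonZero D}} → kept + dropped ≡ q →
                     D * dropped ≤ w * r → 2 * r * w ≤ q * D → q ≤ 2 * kept
at-least-half-kept {q} {kept} {dropped} {r} {w} {D} split budget 2rw≤qD = begin
  q                ≡⟨ split ⟨
  kept + dropped   ≤⟨ +-monoʳ-≤ kept dropped≤kept ⟩
  kept + kept      ≡⟨ cong (kept +_) (+-identityʳ kept) ⟨
  2 * kept         ∎
  where
    open ≤-Reasoning

    twice-dropped : D * (2 * dropped) ≤ D * q
    twice-dropped = begin
      D * (2 * dropped)  ≡⟨ CommutativeSemigroupProperties.x∙yz≈y∙xz *-commutativeSemigroup D 2 dropped ⟩
      2 * (D * dropped)  ≤⟨ *-monoʳ-≤ 2 budget ⟩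
      2 * (w * r)        ≡⟨ cong (2 *_) (*-comm w r) ⟩
      2 * (r * w)        ≡⟨ *-assoc 2 r w ⟨
      2 * r * w          ≤⟨ 2rw≤qD ⟩
      q * D              ≡⟨ *-comm q D ⟩
      D * q              ∎

    dropped≤kept : dropped ≤ kept
    dropped≤kept = +-cancelʳ-≤ dropped dropped kept (begin
      dropped + dropped   ≡⟨ cong (dropped +_) (+-identityʳ dropped) ⟨
      2 * dropped         ≤⟨ *-cancelˡ-≤ D twice-dropped ⟩
      q                   ≡⟨ split ⟨
      kept + dropped      ∎)

lemma4p12 : (G : Graph) (r q : ℕ) (R : Fin r → Path G) (Q : Fin q → Path G) →
    NodeDisjoint R → NodeDisjoint Q →
    (w D : ℕ) → 0 < w → 0 < D →
    ((j : Fin q) → IntersectsAtLeast (2 * D) (Q j) R ⊤) →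
    2 * r * w ≤ q * D →
    ∃ λ (R′ : Subset r) → ∃ λ (Q′ : Subset q) →
      IsIntersectingPair w D R R′ Q Q′ ×
      q ≤ 2 * ∣ Q′ ∣ ×
      ((i : Fin r) → i ∈ ∁ R′ → IntersectsAtMost w (R i) Q Q′)
lemma4p12 G r q R Q _ _ w D _ D>0 heavy 2rw≤qD =
  let (R′ , Q′ , pair , budget , discarded-light) = prune-intersecting R Q w D heavy in
  R′ , Q′ , pair ,
  at-least-half-kept {r = r} {w} {{>-nonZero D>0}} (∣p∣+∣∁p∣≡n Q′)
    (≤-trans budget (*-monoʳ-≤ w (∣p∣≤n (∁ R′)))) 2rw≤qD ,
  discarded-light
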